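{- $f_{3,2}=3/4$ and $f_{4,2}=175/256$.
   Context: A $k$-graph $H$ has vertex set $V(H)$ and edges which are $k$-subsets of $V(H)$; $\delta_1(H)$ is its minimum vertex degree. Given a partition $\{V_1,\dots,V_r\}$ of $V(H)$, an edge $e$ has type $(j_1,\dots,j_r)$ if $|e\cap V_i|=j_i$ for all $i$; $\mathbf e_i$ is the $i$th standard unit vector of $\mathbb Z^r$. For $k,r\ge 2$, $(\mathbf j,\sigma)$ with $\mathbf j\in\mathbb N_0^r$, $\sigma\in\{ -1,1\}$ is $k$-valid if $\sigma+\sum_i j_i=k$ and $j_i+\sigma\ge0$ for all $i$. An $r$-edge-coloured $k$-graph $H$ is in $\mathcal F_{k,r}(\mathbf j,\sigma)$ if $n=|V(H)|$ is divisible by $kr$ and there is a partition $\{V_1,\dots,V_r\}$ of $V(H)$ with $|V_i|=\frac{rj_i+\sigma}{rk}n$ for all $i$ such that for each $i\in[r]$ every edge of colour $i$ has type $\mathbf j+\sigma\mathbf e_i$. $\mathcal F_{k,r}$ is the union over all $k$-valid pairs, and \[f_{k,r}:=\lim_{n\to\infty}\max_{H\in\mathcal F_{k,r},\,|V(H)|=krn}\frac{\delta_1(H)}{\binom{|V(H)|-1}{k-1}}.\] -}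

module Defs where

open import Data.Nat.Divisibility as ℕ using (_∣_)
open import Data.Nat as ℕ using (ℕ; zero; suc; _⊓_; _∸_)
open import Data.Nat.Combinatorics using (_C_)
open import Data.Integer as ℤ using (ℤ; +_)
open import Data.Rational as ℚ using (ℚ; 0ℚ; _/_; ∣_∣; _-_; _<_; _≤_)
open import Data.Bool using (Bool; true; false; _∧_; if_then_else_)
open import Data.Maybe using (Maybe; just; nothing; is-just)
open import Data.Fin using (Fin; _≟_)
open import Data.Fin.Subset using (Subset; inside; outside)
open import Data.Fin.Subset renaming (∣_∣ to size) public using ()
open import Data.Vec using (Vec; []; _∷_; lookup)
open import Data.List using (List; []; _∷_; map; _++_; foldr; allFin)
open import Data.Product using (Σ; ∃; _×_; _,_)
open import Data.Sum using (_⊎_)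
open import Relation.Binary.PropositionalEquality using (_≡_)
open import Relation.Nullary.Decidable using (⌊_⌋)

count : {A : Set} → (A → Bool) → List A → ℕ
count p [] = 0
count p (x ∷ xs) = if p x then suc (count p xs) else count p xs

allSubsets : (N : ℕ) → List (Subset N)
allSubsets zero = [] ∷ []
allSubsets (suc N) = map (outside ∷_) (allSubsets N) ++ map (inside ∷_) (allSubsets N)

-- An r-edge-coloured k-graph on vertex set Fin N:
-- col e = nothing means e is not an edge, col e = just i means e is an edge of colour i.
record ColouredGraph (k r N : ℕ) : Set where
  field
    col     : Subset N → Maybe (Fin r)
    uniform : ∀ e i → col e ≡ just i → size e ≡ k
open ColouredGraph public

deg : ∀ {k r N} → ColouredGraph k r N → Fin N → ℕ
deg H v = count (λ e → is-just (col H e) ∧ lookup e v) (allSubsets _)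

-- minimum vertex degree δ₁(H) (convention: 0 for the empty vertex set)
δ₁ : ∀ {k r N} → ColouredGraph k r N → ℕ
δ₁ {N = zero} H = 0
δ₁ {N = suc N} H = foldr _⊓_ (deg H Fin.zero) (map (deg H) (allFin (suc N)))
  where import Data.Fin as Fin

-- a / b as a rational (convention: 0 when b = 0)
frac : ℕ → ℕ → ℚ
frac a zero = 0ℚ
frac a (suc b) = (+ a) / suc b

ratio : ∀ {k r N} → ColouredGraph k r N → ℚ
ratio {k} {r} {N} H = frac (δ₁ H) ((N ∸ 1) C (k ∸ 1))

IsSign : ℤ → Set
IsSign σ = σ ≡ ℤ.+ 1 ⊎ σ ≡ ℤ.- (ℤ.+ 1)

Valid : (k r : ℕ) → (Fin r → ℕ) → ℤ → Set
Valid k r j σ = IsSign σ × (σ ℤ.+ + (foldr ℕ._+_ 0 (map j (allFin r))) ≡ + k)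
                × (∀ i → + 0 ℤ.≤ + j i ℤ.+ σ)

shift : ∀ {r} → (Fin r → ℕ) → ℤ → Fin r → Fin r → ℤ
shift j σ i l = if ⌊ i ≟ l ⌋ then + j l ℤ.+ σ else + j l

-- H ∈ F_{k,r}(j, σ), with partition given by part : V(H) → Fin r (V_i = part⁻¹(i))
InFjσ : ∀ {k r N} → (Fin r → ℕ) → ℤ → ColouredGraph k r N → Set
InFjσ {k} {r} {N} j σ H =
  (k ℕ.* r) ℕ.∣ N ×
  Σ (Fin N → Fin r) λ part →
    (∀ i → + (count (λ v → ⌊ part v ≟ i ⌋) (allFin N)) ℤ.* (+ (r ℕ.* k))
             ≡ (+ r ℤ.* + j i ℤ.+ σ) ℤ.* + N)
    × (∀ e i → col H e ≡ just i →
         ∀ l → + (count (λ v → lookup e v ∧ ⌊ part v ≟ l ⌋) (allFin N)) ≡ shift j σ i l)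

InF : ∀ {k r N} → ColouredGraph k r N → Set
InF {k} {r} H = Σ (Fin r → ℕ) λ j → Σ ℤ λ σ → Valid k r j σ × InFjσ j σ H

IsMaxRatio : (k r n : ℕ) → ℚ → Set
IsMaxRatio k r n x =
  (Σ (ColouredGraph k r (k ℕ.* r ℕ.* n)) λ H → InF H × ratio H ≡ x)
  × (∀ (H : ColouredGraph k r (k ℕ.* r ℕ.* n)) → InF H → ratio H ≤ x)

Converges : (ℕ → ℚ) → ℚ → Set
Converges a L = ∀ ε → 0ℚ < ε → ∃ λ M → ∀ n → M ℕ.≤ n → ∣ a n - L ∣ < ε

fIs : (k r : ℕ) → ℚ → Set
fIs k r L = Σ (ℕ → ℚ) λ a → (∀ n → IsMaxRatio k r n (a n)) × Converges a L

{-# OPTIONS --safe #-}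
module Submission where

-- For two colours and k = m + 1, a k-valid pair (j , σ) is a split p + q = m in disguise: the parts
-- have (2p + 1)n and (2q + 1)n vertices and every edge has type (p + 1 , q) or (p , q + 1).  A vertex
-- of such a graph lies in at most as many edges as in the graph carrying all edges of both types,
-- which belongs to the family itself; so the maximum is attained by the best split, and its minimum
-- degree is an explicit sum of products of binomial coefficients in n.  For k = 3 the split (1 , 1)
-- and for k = 4 the split (1 , 2) reach L·binom(2kn − 1, k − 1), while no split exceeds
-- (L + 1/n)·binom(2kn − 1, k − 1), with L = 3/4 and L = 175/256; both facts are inequalities
-- between polynomials in n with natural coefficients.

open import Defs
open import Data.Bool using (Bool; true; false; _∧_; _∨_; if_then_else_; T)
open import Data.Bool.Properties using (∧-comm; ∧-zeroʳ; ∧-distribˡ-∨; T-∧; T-∨)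
open import Data.Empty using (⊥; ⊥-elim)
open import Data.Fin using (Fin; zero; suc; _≟_; opposite)
open import Data.Fin.Subset using (Subset; inside; outside)
open import Data.Integer as ℤ using (ℤ; +≤+; +<+)
import Data.Integer.Properties as ℤ
open import Data.List using (List; []; _∷_; map; _++_; allFin; tabulate)
open import Data.List.Membership.Propositional using (_∈_)
open import Data.List.Membership.Propositional.Properties using (∈-map⁺)
open import Data.List.Properties using (foldr-preservesᵇ; foldr-preservesᵒ)
open import Data.List.Relation.Unary.All as All using (All; []; _∷_)
import Data.List.Relation.Unary.All.Properties as All
open import Data.List.Relation.Unary.Any using (here; there)
import Data.List.Relation.Unary.Any.Properties as Any
open import Data.Maybe using (Maybe; just; nothing; is-just)
open import Data.Nat using (ℕ; zero; suc; pred; _+_; _*_; _∸_; _≤_; _<_; _⊓_; _≡ᵇ_; _≤ᵇ_; _!; z≤n; s≤s; NonZero)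
open import Data.Nat.Combinatorics using (_C_; nCk+nC[k+1]≡[n+1]C[k+1]; nC1≡n)
open import Data.Nat.Coprimality using (Coprime)
open import Data.Nat.Divisibility using (m∣m*n)
open import Data.Nat.Properties
  using (module ≤-Reasoning; ≤-totalOrder; ≤-refl; ≤-reflexive; ≤-trans; n≤1+n; n≤0⇒n≡0; suc-injective; 1+n≢n;
         ≡ᵇ⇒≡; ≡⇒≡ᵇ; ≤ᵇ⇒≤; +-comm; +-suc; +-identityʳ; +-mono-≤; m≤m+n; m≤n+o⇒m∸n≤o; ∸-monoˡ-≤;
         *-comm; *-suc; *-zeroʳ; *-identityʳ; *-distribʳ-+; *-distribˡ-+; *-distribʳ-∸; *-distribˡ-⊓;
         *-cancelʳ-≡; *-cancelˡ-≤; *-monoʳ-≤; *-monoˡ-≤; *-monoʳ-<; m≤m*n;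
         ⊓-glb; m⊓n≤m; m⊓n≤n; m≤n⇒m⊓o≤n; m≤n⇒o⊓m≤n)
open import Data.Nat.Tactic.RingSolver using (solve-∀)
open import Data.List.Extrema ≤-totalOrder using (argmax; argmax-all; f[xs]≤f[argmax])
open import Data.Product using (∃-syntax; _×_; _,_; proj₁; proj₂; map₁; uncurry)
open import Data.Rational as ℚ using (ℚ; mkℚ; toℚᵘ)
import Data.Rational.Properties as ℚ
open import Data.Rational.Unnormalised as ℚᵘ using (mkℚᵘ; *≤*; *<*)
import Data.Rational.Unnormalised.Properties as ℚᵘ
open import Data.Sum using (_⊎_; inj₁; inj₂; [_,_])
open import Data.Unit using (tt)
open import Data.Vec using ([]; _∷_; lookup)
open import Function using (_∘_; id)
open import Function.Bundles using (Equivalence)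
open import Relation.Binary.PropositionalEquality hiding ([_])
open import Relation.Nullary.Decidable using (⌊_⌋; fromWitness; toWitness)

private variable
  A : Set
  N : ℕ

-- Counting

countFin : (Fin N → Bool) → ℕ
countFin {zero}  p = 0
countFin {suc N} p = if p zero then suc (countFin (p ∘ suc)) else countFin (p ∘ suc)

count-tabulate : ∀ (p : A → Bool) (f : Fin N → A) → count p (tabulate f) ≡ countFin (p ∘ f)
count-tabulate {N = zero}  p f = refl
count-tabulate {N = suc N} p f rewrite count-tabulate p (f ∘ suc) = refl

count-allFin : ∀ (p : Fin N → Bool) → count p (allFin N) ≡ countFin p
count-allFin p = count-tabulate p id

countFin-cong : ∀ {p q : Fin N → Bool} → (∀ v → p v ≡ q v) → countFin p ≡ countFin q
countFin-cong {zero}  eq = refl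
countFin-cong {suc N} eq rewrite eq zero | countFin-cong (eq ∘ suc) = refl

countFin-const : ∀ N b → countFin {N} (λ _ → b) ≡ (if b then N else 0)
countFin-const zero    true  = refl
countFin-const zero    false = refl
countFin-const (suc N) true  = cong suc (countFin-const N true)
countFin-const (suc N) false = countFin-const N false

countFin-pos : ∀ (p : Fin N → Bool) v → T (p v) → 1 ≤ countFin p
countFin-pos p zero    pv with p zero
... | true = s≤s z≤n
countFin-pos p (suc v) pv with p zero
... | true  = s≤s z≤n
... | false = countFin-pos (p ∘ suc) v pv

countFin-witness : ∀ (p : Fin N → Bool) → 1 ≤ countFin p → ∃[ v ] T (p v)
countFin-witness {suc N} p pos with p zero in eq
... | true  = zero , subst T (sym eq) tt
... | false = let v , pv = countFin-witness (p ∘ suc) pos in suc v , pv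

count-cong : ∀ {p q : A → Bool} (xs : List A) → (∀ x → p x ≡ q x) → count p xs ≡ count q xs
count-cong []       eq = refl
count-cong (x ∷ xs) eq rewrite eq x | count-cong xs eq = refl

count-false : ∀ (xs : List A) → count (λ _ → false) xs ≡ 0
count-false []       = refl
count-false (x ∷ xs) = count-false xs

count-++ : ∀ (p : A → Bool) xs ys → count p (xs ++ ys) ≡ count p xs + count p ys
count-++ p []       ys = refl
count-++ p (x ∷ xs) ys with p x
... | true  = cong suc (count-++ p xs ys)
... | false = count-++ p xs ys

count-map : ∀ {B : Set} (p : B → Bool) (f : A → B) xs → count p (map f xs) ≡ count (p ∘ f) xs
count-map p f []       = refl
count-map p f (x ∷ xs) with p (f x)
... | true  = cong suc (count-map p f xs)
... | false = count-map p f xs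

count-∨+count-∧ : ∀ (p q : A → Bool) xs →
  count (λ x → p x ∨ q x) xs + count (λ x → p x ∧ q x) xs ≡ count p xs + count q xs
count-∨+count-∧ p q []       = refl
count-∨+count-∧ p q (x ∷ xs) with p x | q x | count-∨+count-∧ p q xs
... | true  | true  | ih = cong suc (trans (+-suc _ _) (trans (cong suc ih) (sym (+-suc _ _))))
... | true  | false | ih = cong suc ih
... | false | true  | ih = trans (cong suc ih) (sym (+-suc _ _))
... | false | false | ih = ih

count-mono : ∀ {p q : A → Bool} (xs : List A) → (∀ x → T (p x) → T (q x)) → count p xs ≤ count q xs
count-mono [] p⇒q = z≤n
count-mono {p = p} {q} (x ∷ xs) p⇒q with p x in px | q x in qx
... | true  | true  = s≤s (count-mono xs p⇒q)
... | true  | false = ⊥-elim (subst T qx (p⇒q x (subst T (sym px) tt)))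
... | false | true  = ≤-trans (count-mono xs p⇒q) (n≤1+n _)
... | false | false = count-mono xs p⇒q

count-∨-disjoint : ∀ (p q : A → Bool) xs → (∀ x → T (p x) → T (q x) → ⊥) →
  count (λ x → p x ∨ q x) xs ≡ count p xs + count q xs
count-∨-disjoint p q xs disjoint = begin
  count (λ x → p x ∨ q x) xs                                 ≡⟨ +-identityʳ _ ⟨
  count (λ x → p x ∨ q x) xs + 0                             ≡⟨ cong (count (λ x → p x ∨ q x) xs +_) both≡0 ⟨
  count (λ x → p x ∨ q x) xs + count (λ x → p x ∧ q x) xs    ≡⟨ count-∨+count-∧ p q xs ⟩
  count p xs + count q xs                                    ∎
  where
  open ≡-Reasoning
  both≡0 : count (λ x → p x ∧ q x) xs ≡ 0
  both≡0 = n≤0⇒n≡0 (≤-trans (count-mono xs (λ x h → let px , qx = Equivalence.to T-∧ h in disjoint x px qx))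
                            (≤-reflexive (count-false xs)))

count-allSubsets-suc : ∀ (p : Subset (suc N) → Bool) →
  count p (allSubsets (suc N)) ≡ count (p ∘ (outside ∷_)) (allSubsets N) + count (p ∘ (inside ∷_)) (allSubsets N)
count-allSubsets-suc {N} p = trans (count-++ p (map (outside ∷_) (allSubsets N)) (map (inside ∷_) (allSubsets N)))
  (cong₂ _+_ (count-map p (outside ∷_) (allSubsets N)) (count-map p (inside ∷_) (allSubsets N)))

-- Subsets of a two-part partition

Partition : ℕ → Set
Partition N = Fin N → Fin 2

partSize : Partition N → Fin 2 → ℕ
partSize χ l = countFin (λ v → ⌊ χ v ≟ l ⌋)

meet : Partition N → Fin 2 → Subset N → ℕ
meet χ l e = countFin (λ v → lookup e v ∧ ⌊ χ v ≟ l ⌋)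

hasType : Partition N → ℕ → ℕ → Subset N → Bool
hasType χ a b e = (meet χ zero e ≡ᵇ a) ∧ (meet χ (suc zero) e ≡ᵇ b)

hasType-sound : ∀ (χ : Partition N) a b e → T (hasType χ a b e) → meet χ zero e ≡ a × meet χ (suc zero) e ≡ b
hasType-sound χ a b e h = let h₀ , h₁ = Equivalence.to T-∧ h in ≡ᵇ⇒≡ _ _ h₀ , ≡ᵇ⇒≡ _ _ h₁

hasType-complete : ∀ (χ : Partition N) {a b} e → meet χ zero e ≡ a → meet χ (suc zero) e ≡ b →
  T (hasType χ a b e)
hasType-complete χ e refl refl =
  Equivalence.from (T-∧ {meet χ zero e ≡ᵇ _}) (≡⇒≡ᵇ (meet χ zero e) _ refl , ≡⇒≡ᵇ (meet χ (suc zero) e) _ refl)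

size≡meet+meet : ∀ (χ : Partition N) e → size e ≡ meet χ zero e + meet χ (suc zero) e
size≡meet+meet χ []          = refl
size≡meet+meet χ (false ∷ e) = size≡meet+meet (χ ∘ suc) e
size≡meet+meet χ (true ∷ e) with χ zero
... | zero       = cong suc (size≡meet+meet (χ ∘ suc) e)
... | suc zero   = trans (cong suc (size≡meet+meet (χ ∘ suc) e)) (sym (+-suc _ _))

≟-opposite : ∀ (x l : Fin 2) → ⌊ opposite x ≟ l ⌋ ≡ ⌊ x ≟ opposite l ⌋
≟-opposite zero       zero       = refl
≟-opposite zero       (suc zero) = refl
≟-opposite (suc zero) zero       = refl
≟-opposite (suc zero) (suc zero) = refl

partSize-opposite : ∀ (χ : Partition N) l → partSize (opposite ∘ χ) l ≡ partSize χ (opposite l)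
partSize-opposite χ l = countFin-cong (λ v → ≟-opposite (χ v) l)

meet-opposite : ∀ (χ : Partition N) l e → meet (opposite ∘ χ) l e ≡ meet χ (opposite l) e
meet-opposite χ l e = countFin-cong (λ v → cong (lookup e v ∧_) (≟-opposite (χ v) l))

hasType-opposite : ∀ (χ : Partition N) a b e → hasType (opposite ∘ χ) b a e ≡ hasType χ a b e
hasType-opposite χ a b e rewrite meet-opposite χ zero e | meet-opposite χ (suc zero) e =
  ∧-comm (meet χ (suc zero) e ≡ᵇ b) (meet χ zero e ≡ᵇ a)

pascal-*ʳ : ∀ n k m → (n C suc k) * m + (n C k) * m ≡ (suc n C suc k) * m
pascal-*ʳ n k m = trans (sym (*-distribʳ-+ m (n C suc k) (n C k)))
  (cong (_* m) (trans (+-comm (n C suc k) (n C k)) (nCk+nC[k+1]≡[n+1]C[k+1] n k)))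

pascal-*ˡ : ∀ m n k → m * (n C suc k) + m * (n C k) ≡ m * (suc n C suc k)
pascal-*ˡ m n k = trans (sym (*-distribˡ-+ m (n C suc k) (n C k)))
  (cong (m *_) (trans (+-comm (n C suc k) (n C k)) (nCk+nC[k+1]≡[n+1]C[k+1] n k)))

typeCount : ∀ (χ : Partition N) a b →
  count (hasType χ a b) (allSubsets N) ≡ (partSize χ zero C a) * (partSize χ (suc zero) C b)
typeCount {zero} χ zero    zero    = refl
typeCount {zero} χ zero    (suc b) = refl
typeCount {zero} χ (suc a) b       = refl
typeCount {suc N} χ a b rewrite count-allSubsets-suc (hasType χ a b) | typeCount (χ ∘ suc) a b with χ zero | a | b
... | zero     | zero  | b     rewrite count-false (allSubsets N) = +-identityʳ _
... | zero     | suc a | b     rewrite typeCount (χ ∘ suc) a b =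
  pascal-*ʳ (partSize (χ ∘ suc) zero) a (partSize (χ ∘ suc) (suc zero) C b)
... | suc zero | a     | zero  rewrite count-cong (allSubsets N) (λ e → ∧-zeroʳ (meet (χ ∘ suc) zero e ≡ᵇ a))
                                   | count-false (allSubsets N) = +-identityʳ _
... | suc zero | a     | suc b rewrite typeCount (χ ∘ suc) a b =
  pascal-*ˡ (partSize (χ ∘ suc) zero C a) (partSize (χ ∘ suc) (suc zero)) b

typeDegree : ℕ → ℕ → ℕ → ℕ → ℕ
typeDegree s t zero    b = 0
typeDegree s t (suc a) b = (pred s C a) * (t C b)

typeDegree-pascalˡ : ∀ s t a b → 1 ≤ s →
  typeDegree s t (suc a) b + typeDegree s t a b ≡ typeDegree (suc s) t (suc a) b
typeDegree-pascalˡ (suc s) t zero    b _ = +-identityʳ _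
typeDegree-pascalˡ (suc s) t (suc a) b _ = pascal-*ʳ s a (t C b)

typeDegree-pascalʳ : ∀ s t a b →
  typeDegree s t a (suc b) + typeDegree s t a b ≡ typeDegree s (suc t) a (suc b)
typeDegree-pascalʳ s t zero    b = refl
typeDegree-pascalʳ s t (suc a) b = pascal-*ˡ (pred s C a) t b

typeDegree-zeroʳ : ∀ s t a → typeDegree s t a 0 + 0 ≡ typeDegree s (suc t) a 0
typeDegree-zeroʳ s t zero    = refl
typeDegree-zeroʳ s t (suc a) = +-identityʳ _

vertexTypeCount : ∀ (χ : Partition N) v a b → χ v ≡ zero →
  count (λ e → lookup e v ∧ hasType χ a b e) (allSubsets N) ≡ typeDegree (partSize χ zero) (partSize χ (suc zero)) a b
vertexTypeCount {suc N} χ zero a b χv rewrite count-allSubsets-suc (λ e → lookup e zero ∧ hasType χ a b e)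
                                            | count-false (allSubsets N) | χv with a
... | zero  = count-false (allSubsets N)
... | suc a = typeCount (χ ∘ suc) a b
vertexTypeCount {suc N} χ (suc v) a b χv rewrite count-allSubsets-suc (λ e → lookup e (suc v) ∧ hasType χ a b e)
                                               | vertexTypeCount (χ ∘ suc) v a b χv with χ zero | a | b
... | zero     | zero  | b     rewrite count-cong (allSubsets N) (λ e → ∧-zeroʳ (lookup e v))
                                     | count-false (allSubsets N) = refl
... | zero     | suc a | b     rewrite vertexTypeCount (χ ∘ suc) v a b χv =
  typeDegree-pascalˡ (partSize (χ ∘ suc) zero) (partSize (χ ∘ suc) (suc zero)) a b (countFin-pos _ v (fromWitness χv))
... | suc zero | a     | zero  rewrite count-cong (allSubsets N)
                                         (λ e → cong (lookup e v ∧_) (∧-zeroʳ (meet (χ ∘ suc) zero e ≡ᵇ a)))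
                                     | count-cong (allSubsets N) (λ e → ∧-zeroʳ (lookup e v))
                                     | count-false (allSubsets N) =
  typeDegree-zeroʳ (partSize (χ ∘ suc) zero) (partSize (χ ∘ suc) (suc zero)) a
... | suc zero | a     | suc b rewrite vertexTypeCount (χ ∘ suc) v a b χv =
  typeDegree-pascalʳ (partSize (χ ∘ suc) zero) (partSize (χ ∘ suc) (suc zero)) a b

vertexTypeCount-opposite : ∀ (χ : Partition N) v a b → χ v ≡ suc zero →
  count (λ e → lookup e v ∧ hasType χ a b e) (allSubsets N) ≡ typeDegree (partSize χ (suc zero)) (partSize χ zero) b a
vertexTypeCount-opposite {N} χ v a b χv = begin
  count (λ e → lookup e v ∧ hasType χ a b e) (allSubsets N)
    ≡⟨ count-cong (allSubsets N) (λ e → cong (lookup e v ∧_) (sym (hasType-opposite χ a b e))) ⟩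
  count (λ e → lookup e v ∧ hasType (opposite ∘ χ) b a e) (allSubsets N)
    ≡⟨ vertexTypeCount (opposite ∘ χ) v b a (cong opposite χv) ⟩
  typeDegree (partSize (opposite ∘ χ) zero) (partSize (opposite ∘ χ) (suc zero)) b a
    ≡⟨ cong₂ (λ s t → typeDegree s t b a) (partSize-opposite χ zero) (partSize-opposite χ (suc zero)) ⟩
  typeDegree (partSize χ (suc zero)) (partSize χ zero) b a ∎
  where open ≡-Reasoning

-- Minimum degree of graphs whose edges respect a split

δ₁≤deg : ∀ {k r N} (H : ColouredGraph k r N) v → δ₁ H ≤ deg H v
δ₁≤deg {N = suc N} H v = foldr-preservesᵒ {P = _≤ deg H v} {f = _⊓_}
  (λ x y → [ m≤n⇒m⊓o≤n y , m≤n⇒o⊓m≤n x ]) _ _ (inj₂ (Any.map⁺ (Any.tabulate⁺ {f = id} v ≤-refl)))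

δ₁-greatest : ∀ {k r N x} (H : ColouredGraph k r (suc N)) → (∀ v → x ≤ deg H v) → x ≤ δ₁ H
δ₁-greatest {x = x} H x≤deg =
  foldr-preservesᵇ {P = x ≤_} {f = _⊓_} ⊓-glb (x≤deg zero) (All.map⁺ (All.tabulate⁺ {f = id} x≤deg))

δ₁-empty : ∀ {k r N} (H H′ : ColouredGraph k r N) → N ≡ 0 → δ₁ H ≤ δ₁ H′
δ₁-empty {N = zero} H H′ _ = z≤n

isSplitEdge : Partition N → ℕ → ℕ → Subset N → Bool
isSplitEdge χ p q e = hasType χ (suc p) q e ∨ hasType χ p (suc q) e

-- s and p belong to the part containing the vertex, t and q to the other part
splitDegree : ℕ → ℕ → ℕ → ℕ → ℕ
splitDegree s t p q = typeDegree s t (suc p) q + typeDegree s t p (suc q)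

splitMinDegree : ℕ → ℕ → ℕ → ℕ → ℕ
splitMinDegree s t p q = splitDegree s t p q ⊓ splitDegree t s q p

splitTypeCount : Partition N → ℕ → ℕ → Fin N → ℕ
splitTypeCount {N} χ p q v = count (λ e → lookup e v ∧ hasType χ (suc p) q e) (allSubsets N)
                           + count (λ e → lookup e v ∧ hasType χ p (suc q) e) (allSubsets N)

splitTypeCount-first : ∀ (χ : Partition N) p q v → χ v ≡ zero →
  splitTypeCount χ p q v ≡ splitDegree (partSize χ zero) (partSize χ (suc zero)) p q
splitTypeCount-first χ p q v χv = cong₂ _+_ (vertexTypeCount χ v (suc p) q χv) (vertexTypeCount χ v p (suc q) χv)

splitTypeCount-second : ∀ (χ : Partition N) p q v → χ v ≡ suc zero →
  splitTypeCount χ p q v ≡ splitDegree (partSize χ (suc zero)) (partSize χ zero) q p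
splitTypeCount-second χ p q v χv =
  trans (cong₂ _+_ (vertexTypeCount-opposite χ v (suc p) q χv) (vertexTypeCount-opposite χ v p (suc q) χv))
        (+-comm (typeDegree (partSize χ (suc zero)) (partSize χ zero) q (suc p)) _)

splitMinDegree≤splitTypeCount : ∀ (χ : Partition N) p q v →
  splitMinDegree (partSize χ zero) (partSize χ (suc zero)) p q ≤ splitTypeCount χ p q v
splitMinDegree≤splitTypeCount χ p q v with χ v in χv
... | zero       = ≤-trans (m⊓n≤m _ _) (≤-reflexive (sym (splitTypeCount-first χ p q v χv)))
... | suc zero   = ≤-trans (m⊓n≤n _ _) (≤-reflexive (sym (splitTypeCount-second χ p q v χv)))

vertexIn : ∀ (χ : Partition N) l → 1 ≤ partSize χ l → ∃[ v ] χ v ≡ l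
vertexIn χ l pos = let v , χv = countFin-witness _ pos in v , toWitness χv

deg≤splitTypeCount : ∀ {k r} (H : ColouredGraph k r N) (χ : Partition N) p q →
  (∀ e → T (is-just (col H e)) → T (isSplitEdge χ p q e)) → ∀ v → deg H v ≤ splitTypeCount χ p q v
deg≤splitTypeCount {N} H χ p q splitEdges v = begin
  count (λ e → is-just (col H e) ∧ lookup e v) (allSubsets N)       ≤⟨ count-mono (allSubsets N) edgeThroughV ⟩
  count (λ e → (lookup e v ∧ T₁ e) ∨ (lookup e v ∧ T₂ e)) (allSubsets N)
    ≤⟨ m≤m+n _ _ ⟩
  count (λ e → (lookup e v ∧ T₁ e) ∨ (lookup e v ∧ T₂ e)) (allSubsets N)
    + count (λ e → (lookup e v ∧ T₁ e) ∧ (lookup e v ∧ T₂ e)) (allSubsets N)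
    ≡⟨ count-∨+count-∧ (λ e → lookup e v ∧ T₁ e) (λ e → lookup e v ∧ T₂ e) (allSubsets N) ⟩
  splitTypeCount χ p q v ∎
  where
  open ≤-Reasoning
  T₁ T₂ : Subset N → Bool
  T₁ = hasType χ (suc p) q
  T₂ = hasType χ p (suc q)
  edgeThroughV : ∀ e → T (is-just (col H e) ∧ lookup e v) → T ((lookup e v ∧ T₁ e) ∨ (lookup e v ∧ T₂ e))
  edgeThroughV e h = let isEdge , v∈e = Equivalence.to T-∧ h in
    subst T (∧-distribˡ-∨ (lookup e v) (T₁ e) (T₂ e)) (Equivalence.from T-∧ (v∈e , splitEdges e isEdge))

record SplitShape {k N} (H : ColouredGraph k 2 N) (s t p q : ℕ) : Set where
  field
    part        : Partition N
    size-first  : partSize part zero ≡ s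
    size-second : partSize part (suc zero) ≡ t
    splitEdges  : ∀ e → T (is-just (col H e)) → T (isSplitEdge part p q e)

δ₁≤splitMinDegree : ∀ {k s t p q} {H : ColouredGraph k 2 N} → SplitShape H s t p q → 1 ≤ s → 1 ≤ t →
  δ₁ H ≤ splitMinDegree s t p q
δ₁≤splitMinDegree {s = s} {t} {p} {q} {H} shape 1≤s 1≤t = ⊓-glb first second
  where
  open SplitShape shape
  open ≤-Reasoning
  first : δ₁ H ≤ splitDegree s t p q
  first with v , χv ← vertexIn part zero (subst (1 ≤_) (sym size-first) 1≤s) = begin
    δ₁ H                       ≤⟨ δ₁≤deg H v ⟩
    deg H v                    ≤⟨ deg≤splitTypeCount H part p q splitEdges v ⟩
    splitTypeCount part p q v  ≡⟨ splitTypeCount-first part p q v χv ⟩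
    splitDegree (partSize part zero) (partSize part (suc zero)) p q
      ≡⟨ cong₂ (λ s t → splitDegree s t p q) size-first size-second ⟩
    splitDegree s t p q        ∎
  second : δ₁ H ≤ splitDegree t s q p
  second with v , χv ← vertexIn part (suc zero) (subst (1 ≤_) (sym size-second) 1≤t) = begin
    δ₁ H                       ≤⟨ δ₁≤deg H v ⟩
    deg H v                    ≤⟨ deg≤splitTypeCount H part p q splitEdges v ⟩
    splitTypeCount part p q v  ≡⟨ splitTypeCount-second part p q v χv ⟩
    splitDegree (partSize part (suc zero)) (partSize part zero) q p
      ≡⟨ cong₂ (λ t s → splitDegree t s q p) size-second size-first ⟩
    splitDegree t s q p        ∎

splitTypes-disjoint : ∀ (χ : Partition N) p q e → T (hasType χ (suc p) q e) → T (hasType χ p (suc q) e) → ⊥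
splitTypes-disjoint χ p q e h₁ h₂ =
  1+n≢n (trans (sym (proj₁ (hasType-sound χ _ _ e h₁))) (proj₁ (hasType-sound χ _ _ e h₂)))

splitColour : Partition N → ℕ → ℕ → Subset N → Maybe (Fin 2)
splitColour χ p q e =
  if hasType χ (suc p) q e then just zero else if hasType χ p (suc q) e then just (suc zero) else nothing

is-just-splitColour : ∀ (χ : Partition N) p q e → is-just (splitColour χ p q e) ≡ isSplitEdge χ p q e
is-just-splitColour χ p q e with hasType χ (suc p) q e | hasType χ p (suc q) e
... | true  | _     = refl
... | false | true  = refl
... | false | false = refl

splitColour-type : ∀ (χ : Partition N) p q e i → splitColour χ p q e ≡ just i →
  (i ≡ zero × T (hasType χ (suc p) q e)) ⊎ (i ≡ suc zero × T (hasType χ p (suc q) e))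
splitColour-type χ p q e i c with hasType χ (suc p) q e | hasType χ p (suc q) e
splitColour-type χ p q e i refl | true  | _     = inj₁ (refl , tt)
splitColour-type χ p q e i refl | false | true  = inj₂ (refl , tt)

splitGraph : ∀ {m} (χ : Partition N) p q → p + q ≡ m → ColouredGraph (suc m) 2 N
splitGraph {m = m} χ p q pq = record { col = splitColour χ p q ; uniform = edgeSize }
  where
  edgeSize : ∀ e i → splitColour χ p q e ≡ just i → size e ≡ suc m
  edgeSize e i c with splitColour-type χ p q e i c
  ... | inj₁ (_ , h) = let h₀ , h₁ = hasType-sound χ _ _ e h in
    trans (size≡meet+meet χ e) (trans (cong₂ _+_ h₀ h₁) (cong suc pq))
  ... | inj₂ (_ , h) = let h₀ , h₁ = hasType-sound χ _ _ e h in
    trans (size≡meet+meet χ e) (trans (cong₂ _+_ h₀ h₁) (trans (+-suc p q) (cong suc pq)))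

deg-splitGraph : ∀ {m} (χ : Partition N) p q (pq : p + q ≡ m) v →
  deg (splitGraph χ p q pq) v ≡ splitTypeCount χ p q v
deg-splitGraph {N} χ p q pq v = trans (count-cong (allSubsets N) edgeThroughV)
  (count-∨-disjoint (λ e → lookup e v ∧ hasType χ (suc p) q e) (λ e → lookup e v ∧ hasType χ p (suc q) e)
                    (allSubsets N)
    (λ e h₁ h₂ → splitTypes-disjoint χ p q e (proj₂ (Equivalence.to (T-∧ {lookup e v}) h₁))
                                             (proj₂ (Equivalence.to (T-∧ {lookup e v}) h₂))))
  where
  edgeThroughV : ∀ e → is-just (splitColour χ p q e) ∧ lookup e v
                     ≡ (lookup e v ∧ hasType χ (suc p) q e) ∨ (lookup e v ∧ hasType χ p (suc q) e)
  edgeThroughV e = trans (cong (_∧ lookup e v) (is-just-splitColour χ p q e))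
                         (trans (∧-comm _ (lookup e v)) (∧-distribˡ-∨ (lookup e v) _ _))

splitMinDegree≤δ₁ : ∀ {m} (χ : Partition N) p q (pq : p + q ≡ m) → 1 ≤ N →
  splitMinDegree (partSize χ zero) (partSize χ (suc zero)) p q ≤ δ₁ (splitGraph χ p q pq)
splitMinDegree≤δ₁ {suc N} χ p q pq _ = δ₁-greatest (splitGraph χ p q pq)
  (λ v → ≤-trans (splitMinDegree≤splitTypeCount χ p q v) (≤-reflexive (sym (deg-splitGraph χ p q pq v))))

-- The family F_{m+1,2}

pointwise₂ : ∀ {f g : Fin 2 → ℕ} → f zero ≡ g zero × f (suc zero) ≡ g (suc zero) → ∀ l → f l ≡ g l
pointwise₂ (eq₀ , _)   zero       = eq₀
pointwise₂ (_   , eq₁) (suc zero) = eq₁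

splitVector : ℕ → ℕ → Fin 2 → ℕ
splitVector p q zero       = p
splitVector p q (suc zero) = q

-- the type j + eᵢ of the colour-i edges of a member of F(j, 1) with j = (p , q)
edgeVector : ℕ → ℕ → Fin 2 → Fin 2 → ℕ
edgeVector p q zero       = splitVector (suc p) q
edgeVector p q (suc zero) = splitVector p (suc q)

isSplitEdge-edgeVector : ∀ (χ : Partition N) p q i e → (∀ l → meet χ l e ≡ edgeVector p q i l) →
  T (isSplitEdge χ p q e)
isSplitEdge-edgeVector χ p q zero       e h = Equivalence.from T-∨ (inj₁ (hasType-complete χ e (h zero) (h (suc zero))))
isSplitEdge-edgeVector χ p q (suc zero) e h = Equivalence.from T-∨ (inj₂ (hasType-complete χ e (h zero) (h (suc zero))))

oddCoefficient : ∀ x → ℤ.+ 2 ℤ.* ℤ.+ x ℤ.+ ℤ.+ 1 ≡ ℤ.+ suc (2 * x)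
oddCoefficient x = trans (cong (ℤ._+ ℤ.+ 1) (sym (ℤ.pos-* 2 x))) (cong ℤ.+_ (+-comm (2 * x) 1))

oddCoefficient⁻ : ∀ x → ℤ.+ 2 ℤ.* ℤ.+ suc x ℤ.+ ℤ.- ℤ.+ 1 ≡ ℤ.+ suc (2 * x)
oddCoefficient⁻ x = trans (cong (ℤ._+ ℤ.- ℤ.+ 1) (sym (ℤ.pos-* 2 (suc x))))
                          (cong ℤ.+_ (+-suc x (x + 0)))

shift-plus : ∀ j i l → shift j (ℤ.+ 1) i l ≡ ℤ.+ edgeVector (j zero) (j (suc zero)) i l
shift-plus j zero       zero       = cong ℤ.+_ (+-comm (j zero) 1)
shift-plus j zero       (suc zero) = refl
shift-plus j (suc zero) zero       = refl
shift-plus j (suc zero) (suc zero) = cong ℤ.+_ (+-comm (j (suc zero)) 1)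

shift-minus : ∀ j {p q} → j zero ≡ suc p → j (suc zero) ≡ suc q →
  ∀ i l → shift j (ℤ.- ℤ.+ 1) i l ≡ ℤ.+ edgeVector p q (opposite i) l
shift-minus j j₀ j₁ zero       zero       rewrite j₀ = refl
shift-minus j j₀ j₁ zero       (suc zero) rewrite j₁ = refl
shift-minus j j₀ j₁ (suc zero) zero       rewrite j₀ = refl
shift-minus j j₀ j₁ (suc zero) (suc zero) rewrite j₁ = refl

-- For r = 2 and k = m + 1 a k-valid (j , σ) determines a split (p , q) of m:
-- j itself when σ = 1, and j − (1 , 1) when σ = −1.
record SplitOf (m : ℕ) (j : Fin 2 → ℕ) (σ : ℤ) : Set where
  field
    p q        : ℕ
    p+q≡m      : p + q ≡ m
    oddPart    : ∀ i → ℤ.+ 2 ℤ.* ℤ.+ j i ℤ.+ σ ≡ ℤ.+ suc (2 * splitVector p q i)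
    edgeColour : Fin 2 → Fin 2
    shift≡edge : ∀ i l → shift j σ i l ≡ ℤ.+ edgeVector p q (edgeColour i) l

splitOf : ∀ {m j σ} → Valid (suc m) 2 j σ → SplitOf m j σ
splitOf {m} {j} (inj₁ refl , sum , _) = record
  { p = j zero ; q = j (suc zero)
  ; p+q≡m = trans (cong (j zero +_) (sym (+-identityʳ _))) (suc-injective (ℤ.+-injective sum))
  ; oddPart = λ { zero → oddCoefficient (j zero) ; (suc zero) → oddCoefficient (j (suc zero)) }
  ; edgeColour = id
  ; shift≡edge = shift-plus j }
splitOf {m} {j} (inj₂ refl , sum , nonneg) with j zero in j₀ | j (suc zero) in j₁ | nonneg zero | nonneg (suc zero)
... | zero  | _     | () | _
... | suc _ | zero  | _  | ()
... | suc p | suc q | _  | _ = record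
  { p = p ; q = q
  ; p+q≡m = suc-injective (trans (sym (+-suc p q)) (trans (cong (p +_) (sym (+-identityʳ (suc q)))) (ℤ.+-injective sum)))
  ; oddPart = λ { zero → trans (cong (λ x → ℤ.+ 2 ℤ.* ℤ.+ x ℤ.+ ℤ.- ℤ.+ 1) j₀) (oddCoefficient⁻ p)
                ; (suc zero) → trans (cong (λ x → ℤ.+ 2 ℤ.* ℤ.+ x ℤ.+ ℤ.- ℤ.+ 1) j₁) (oddCoefficient⁻ q) }
  ; edgeColour = opposite
  ; shift≡edge = shift-minus j j₀ j₁ }

size-ℤ⇒ℕ : ∀ m n s x → ℤ.+ s ℤ.* ℤ.+ (2 * suc m) ≡ ℤ.+ x ℤ.* ℤ.+ (suc m * 2 * n) → s ≡ x * n
size-ℤ⇒ℕ m n s x eq = *-cancelʳ-≡ s (x * n) (2 * suc m)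
  (trans (ℤ.+-injective (trans (ℤ.pos-* s _) (trans eq (sym (ℤ.pos-* x _))))) (rearrange x (suc m) n))
  where rearrange : ∀ x k n → x * (k * 2 * n) ≡ x * n * (2 * k)
        rearrange = solve-∀

size-ℕ⇒ℤ : ∀ k n s x → s ≡ x * n → ℤ.+ s ℤ.* ℤ.+ (2 * k) ≡ ℤ.+ x ℤ.* ℤ.+ (k * 2 * n)
size-ℕ⇒ℤ k n s x refl =
  trans (sym (ℤ.pos-* (x * n) (2 * k))) (trans (cong ℤ.+_ (rearrange x n k)) (ℤ.pos-* x (k * 2 * n)))
  where rearrange : ∀ x n k → x * n * (2 * k) ≡ x * (k * 2 * n)
        rearrange = solve-∀

InF⇒SplitShape : ∀ {m n} (H : ColouredGraph (suc m) 2 (suc m * 2 * n)) → InF H →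
  ∃[ p ] ∃[ q ] p + q ≡ m × SplitShape H (suc (2 * p) * n) (suc (2 * q) * n) p q
InF⇒SplitShape {m} {n} H (j , σ , valid , _ , χ , sizes , edges) =
  p , q , p+q≡m , record { part = χ ; size-first = sizeOf zero ; size-second = sizeOf (suc zero) ; splitEdges = splitEdges }
  where
  open SplitOf (splitOf valid)
  V : ℕ
  V = suc m * 2 * n
  sizeOf : ∀ i → partSize χ i ≡ suc (2 * splitVector p q i) * n
  sizeOf i = size-ℤ⇒ℕ m n _ (suc (2 * splitVector p q i)) (begin
    ℤ.+ partSize χ i ℤ.* ℤ.+ (2 * suc m)
      ≡⟨ cong (λ c → ℤ.+ c ℤ.* ℤ.+ (2 * suc m)) (count-allFin (λ v → ⌊ χ v ≟ i ⌋)) ⟨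
    ℤ.+ count (λ v → ⌊ χ v ≟ i ⌋) (allFin V) ℤ.* ℤ.+ (2 * suc m)
      ≡⟨ sizes i ⟩
    (ℤ.+ 2 ℤ.* ℤ.+ j i ℤ.+ σ) ℤ.* ℤ.+ V
      ≡⟨ cong (ℤ._* ℤ.+ V) (oddPart i) ⟩
    ℤ.+ suc (2 * splitVector p q i) ℤ.* ℤ.+ V ∎)
    where open ≡-Reasoning
  splitEdges : ∀ e → T (is-just (col H e)) → T (isSplitEdge χ p q e)
  splitEdges e isEdge with col H e in colour
  ... | just i = isSplitEdge-edgeVector χ p q (edgeColour i) e (λ l → ℤ.+-injective (begin
    ℤ.+ meet χ l e                                         ≡⟨ cong ℤ.+_ (count-allFin (λ v → lookup e v ∧ ⌊ χ v ≟ l ⌋)) ⟨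
    ℤ.+ count (λ v → lookup e v ∧ ⌊ χ v ≟ l ⌋) (allFin V)  ≡⟨ edges e i colour l ⟩
    shift j σ i l                                          ≡⟨ shift≡edge i l ⟩
    ℤ.+ edgeVector p q (edgeColour i) l                    ∎))
    where open ≡-Reasoning

splitColour-edgeVector : ∀ (χ : Partition N) p q e i → splitColour χ p q e ≡ just i →
  ∀ l → meet χ l e ≡ edgeVector p q i l
splitColour-edgeVector χ p q e i c with splitColour-type χ p q e i c
... | inj₁ (refl , h) = pointwise₂ (hasType-sound χ _ _ e h)
... | inj₂ (refl , h) = pointwise₂ (hasType-sound χ _ _ e h)

blockPartition : ℕ → Partition N
blockPartition zero    v       = suc zero
blockPartition (suc s) zero    = zero
blockPartition (suc s) (suc v) = blockPartition s v

partSize-blockPartition : ∀ s t → N ≡ s + t →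
  partSize {N} (blockPartition s) zero ≡ s × partSize {N} (blockPartition s) (suc zero) ≡ t
partSize-blockPartition zero    t refl = countFin-const t false , countFin-const t true
partSize-blockPartition (suc s) t refl = let first , second = partSize-blockPartition s t refl in cong suc first , second

vertexCount-split : ∀ {m} n p q → p + q ≡ m → suc m * 2 * n ≡ suc (2 * p) * n + suc (2 * q) * n
vertexCount-split n p q refl = rearrange n p q
  where rearrange : ∀ n p q → suc (p + q) * 2 * n ≡ suc (2 * p) * n + suc (2 * q) * n
        rearrange = solve-∀

extremalGraph : ∀ {m} n p q → p + q ≡ m → ColouredGraph (suc m) 2 (suc m * 2 * n)
extremalGraph n p q pq = splitGraph (blockPartition (suc (2 * p) * n)) p q pq

extremalGraph-InF : ∀ {m} n p q (pq : p + q ≡ m) → InF (extremalGraph n p q pq)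
extremalGraph-InF {m} n p q pq =
  splitVector p q , ℤ.+ 1 , (inj₁ refl , sum , λ _ → +≤+ z≤n) , m∣m*n n , χ , sizes , edges
  where
  V : ℕ
  V = suc m * 2 * n
  χ : Partition V
  χ = blockPartition (suc (2 * p) * n)
  sum : ℤ.+ 1 ℤ.+ ℤ.+ (p + (q + 0)) ≡ ℤ.+ suc m
  sum = cong (λ x → ℤ.+ suc x) (trans (cong (p +_) (+-identityʳ q)) pq)
  partSizes : partSize χ zero ≡ suc (2 * p) * n × partSize χ (suc zero) ≡ suc (2 * q) * n
  partSizes = partSize-blockPartition _ _ (vertexCount-split n p q pq)
  sizeOf : ∀ i → partSize χ i ≡ suc (2 * splitVector p q i) * n
  sizeOf zero       = proj₁ partSizes
  sizeOf (suc zero) = proj₂ partSizes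
  sizes : ∀ i → ℤ.+ count (λ v → ⌊ χ v ≟ i ⌋) (allFin V) ℤ.* ℤ.+ (2 * suc m)
              ≡ (ℤ.+ 2 ℤ.* ℤ.+ splitVector p q i ℤ.+ ℤ.+ 1) ℤ.* ℤ.+ V
  sizes i = trans (cong (λ c → ℤ.+ c ℤ.* ℤ.+ (2 * suc m)) (count-allFin (λ v → ⌊ χ v ≟ i ⌋)))
                  (trans (size-ℕ⇒ℤ (suc m) n (partSize χ i) (suc (2 * splitVector p q i)) (sizeOf i))
                         (cong (ℤ._* ℤ.+ V) (sym (oddCoefficient (splitVector p q i)))))
  edges : ∀ e i → splitColour χ p q e ≡ just i →
          ∀ l → ℤ.+ count (λ v → lookup e v ∧ ⌊ χ v ≟ l ⌋) (allFin V) ≡ shift (splitVector p q) (ℤ.+ 1) i l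
  edges e i c l = trans (cong ℤ.+_ (trans (count-allFin (λ v → lookup e v ∧ ⌊ χ v ≟ l ⌋))
                                          (splitColour-edgeVector χ p q e i c l)))
                        (sym (shift-plus (splitVector p q) i l))

minDegree : ℕ → ℕ → ℕ → ℕ
minDegree n p q = splitMinDegree (suc (2 * p) * n) (suc (2 * q) * n) p q

minDegree≤δ₁-extremalGraph : ∀ {m} t p q (pq : p + q ≡ m) →
  minDegree (suc t) p q ≤ δ₁ (extremalGraph (suc t) p q pq)
minDegree≤δ₁-extremalGraph {m} t p q pq = subst (_≤ δ₁ (extremalGraph (suc t) p q pq))
  (cong₂ (λ s t → splitMinDegree s t p q) (proj₁ sizes) (proj₂ sizes))
  (splitMinDegree≤δ₁ {suc m * 2 * suc t} (blockPartition (suc (2 * p) * suc t)) p q pq (s≤s z≤n))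
  where sizes = partSize-blockPartition {suc m * 2 * suc t} _ _ (vertexCount-split (suc t) p q pq)

δ₁≤minDegree : ∀ {m} t (H : ColouredGraph (suc m) 2 (suc m * 2 * suc t)) → InF H →
  ∃[ p ] ∃[ q ] p + q ≡ m × δ₁ H ≤ minDegree (suc t) p q
δ₁≤minDegree t H H∈F with p , q , pq , shape ← InF⇒SplitShape {n = suc t} H H∈F =
  p , q , pq , δ₁≤splitMinDegree shape (s≤s z≤n) (s≤s z≤n)

-- The best split

splits : ℕ → List (ℕ × ℕ)
splits zero    = (0 , 0) ∷ []
splits (suc m) = (0 , suc m) ∷ map (map₁ suc) (splits m)

∈-splits : ∀ {m} p q → p + q ≡ m → (p , q) ∈ splits m
∈-splits {zero}  zero    zero refl = here refl
∈-splits {suc m} zero    q    refl = here refl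
∈-splits {suc m} (suc p) q    eq   = there (∈-map⁺ (map₁ suc) (∈-splits p q (suc-injective eq)))

splits-sum : ∀ m → All (λ (p , q) → p + q ≡ m) (splits m)
splits-sum zero    = refl ∷ []
splits-sum (suc m) = refl ∷ All.map⁺ (All.map (cong suc) (splits-sum m))

bestSplit : ℕ → ℕ → ℕ × ℕ
bestSplit m n = argmax (uncurry (minDegree n)) (0 , m) (splits m)

bestSplit-sum : ∀ m n → proj₁ (bestSplit m n) + proj₂ (bestSplit m n) ≡ m
bestSplit-sum m n = argmax-all (uncurry (minDegree n)) {P = λ (p , q) → p + q ≡ m} refl (splits-sum m)

minDegree≤best : ∀ {m} n p q → p + q ≡ m → minDegree n p q ≤ uncurry (minDegree n) (bestSplit m n)
minDegree≤best {m} n p q pq = All.lookup (f[xs]≤f[argmax] (0 , m) (splits m)) (∈-splits p q pq)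

bestGraph : ∀ m n → ColouredGraph (suc m) 2 (suc m * 2 * n)
bestGraph m n = extremalGraph n (proj₁ (bestSplit m n)) (proj₂ (bestSplit m n)) (bestSplit-sum m n)

minDegree≤δ₁-bestGraph : ∀ {m} t p q → p + q ≡ m → minDegree (suc t) p q ≤ δ₁ (bestGraph m (suc t))
minDegree≤δ₁-bestGraph {m} t p q pq = ≤-trans (minDegree≤best (suc t) p q pq)
  (minDegree≤δ₁-extremalGraph t (proj₁ (bestSplit m (suc t))) (proj₂ (bestSplit m (suc t))) (bestSplit-sum m (suc t)))

bestGraph-maximal : ∀ m n (H : ColouredGraph (suc m) 2 (suc m * 2 * n)) → InF H → δ₁ H ≤ δ₁ (bestGraph m n)
bestGraph-maximal m zero    H _   = δ₁-empty H (bestGraph m 0) (*-zeroʳ (suc m * 2))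
bestGraph-maximal m (suc t) H H∈F = viaSplit (δ₁≤minDegree t H H∈F)
  where
  viaSplit : ∃[ p ] ∃[ q ] p + q ≡ m × δ₁ H ≤ minDegree (suc t) p q → δ₁ H ≤ δ₁ (bestGraph m (suc t))
  viaSplit (p , q , pq , δ₁≤minDegree) = ≤-trans δ₁≤minDegree (minDegree≤δ₁-bestGraph t p q pq)

completeDegree : ℕ → ℕ → ℕ
completeDegree m n = (suc m * 2 * n ∸ 1) C m

toℚᵘ-frac : ∀ a b → toℚᵘ (frac a (suc b)) ℚᵘ.≃ mkℚᵘ (ℤ.+ a) b
toℚᵘ-frac a b = ℚ.toℚᵘ-fromℚᵘ (mkℚᵘ (ℤ.+ a) b)

frac-mono : ∀ {a b} B → a ≤ b → frac a B ℚ.≤ frac b B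
frac-mono zero    a≤b = ℚ.≤-refl
frac-mono {a} {b} (suc B) a≤b = ℚ.toℚᵘ-cancel-≤
  (ℚᵘ.≤-respʳ-≃ (ℚᵘ.≃-sym (toℚᵘ-frac b B)) (ℚᵘ.≤-respˡ-≃ (ℚᵘ.≃-sym (toℚᵘ-frac a B))
    (*≤* (subst₂ ℤ._≤_ (ℤ.pos-* a (suc B)) (ℤ.pos-* b (suc B)) (+≤+ (*-monoˡ-≤ (suc B) a≤b))))))

maxRatio : ∀ m n → IsMaxRatio (suc m) 2 n (ratio (bestGraph m n))
maxRatio m n = (bestGraph m n , extremalGraph-InF n _ _ (bestSplit-sum m n) , refl)
             , λ H H∈F → frac-mono (completeDegree m n) (bestGraph-maximal m n H H∈F)

-- Convergence of the normalised maxima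

cross-difference : ∀ F G num d → num * G ≤ d * F →
  ℤ.+ F ℤ.* ℤ.+ d ℤ.+ (ℤ.- ℤ.+ num) ℤ.* ℤ.+ G ≡ ℤ.+ (d * F ∸ num * G)
cross-difference F G num d num*G≤d*F = begin
  ℤ.+ F ℤ.* ℤ.+ d ℤ.+ (ℤ.- ℤ.+ num) ℤ.* ℤ.+ G
    ≡⟨ cong₂ ℤ._+_ (trans (cong ℤ.+_ (*-comm d F)) (ℤ.pos-* F d)) (ℤ.neg-distribˡ-* (ℤ.+ num) (ℤ.+ G)) ⟨
  ℤ.+ (d * F) ℤ.+ ℤ.- (ℤ.+ num ℤ.* ℤ.+ G)   ≡⟨ cong (λ x → ℤ.+ (d * F) ℤ.+ ℤ.- x) (ℤ.pos-* num G) ⟨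
  ℤ.+ (d * F) ℤ.- ℤ.+ (num * G)             ≡⟨ ℤ.m-n≡m⊖n (d * F) (num * G) ⟩
  d * F ℤ.⊖ num * G                        ≡⟨ ℤ.⊖-≥ num*G≤d*F ⟩
  ℤ.+ (d * F ∸ num * G)                    ∎
  where open ≡-Reasoning

frac-close : ∀ F G num d a b .(c : Coprime (suc a) (suc b)) → num * suc G ≤ suc d * F →
  (suc d * F ∸ num * suc G) * suc b < suc a * (suc G * suc d) →
  ℚ.∣ frac F (suc G) ℚ.- ℤ.+ num ℚ./ suc d ∣ ℚ.< mkℚ ℤ.+[1+ a ] b c
frac-close F G num d a b c below close = ℚ.toℚᵘ-cancel-< (ℚᵘ.<-respˡ-≃ (ℚᵘ.≃-sym toℚᵘ-distance) (*<* cross))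
  where
  x L : ℚ
  x = frac F (suc G)
  L = ℤ.+ num ℚ./ suc d
  toℚᵘ-distance : toℚᵘ (ℚ.∣ x ℚ.- L ∣) ℚᵘ.≃ ℚᵘ.∣ mkℚᵘ (ℤ.+ F) G ℚᵘ.- mkℚᵘ (ℤ.+ num) d ∣
  toℚᵘ-distance = ℚᵘ.≃-trans (ℚ.toℚᵘ-homo-∣-∣ (x ℚ.- L)) (ℚᵘ.∣-∣-cong (ℚᵘ.≃-trans (ℚ.toℚᵘ-homo-+ x (ℚ.- L))
    (ℚᵘ.+-cong (toℚᵘ-frac F G) (ℚᵘ.≃-trans (ℚ.toℚᵘ-homo‿- L) (ℚᵘ.-‿cong (toℚᵘ-frac num d))))))
  cross : ℤ.+ ℤ.∣ ℤ.+ F ℤ.* ℤ.+ suc d ℤ.+ (ℤ.- ℤ.+ num) ℤ.* ℤ.+ suc G ∣ ℤ.* ℤ.+ suc b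
        ℤ.< ℤ.+[1+ a ] ℤ.* ℤ.+ (suc G * suc d)
  cross rewrite cross-difference F (suc G) num (suc d) below
              | sym (ℤ.pos-* (suc d * F ∸ num * suc G) (suc b))
              | sym (ℤ.pos-* (suc a) (suc G * suc d)) = +<+ close

excess*n≤G*den : ∀ num d F G n → suc d * n * F ≤ (num * n + suc d) * G → (suc d * F ∸ num * G) * n ≤ G * suc d
excess*n≤G*den num d F G n upper = begin
  (suc d * F ∸ num * G) * n     ≡⟨ *-distribʳ-∸ n (suc d * F) (num * G) ⟩
  suc d * F * n ∸ num * G * n   ≤⟨ m≤n+o⇒m∸n≤o _ _ (begin
    suc d * F * n                 ≡⟨ reorderˡ (suc d) F n ⟩
    suc d * n * F                 ≤⟨ upper ⟩
    (num * n + suc d) * G         ≡⟨ reorderʳ num n (suc d) G ⟩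
    num * G * n + G * suc d       ∎) ⟩
  G * suc d                     ∎
  where
  open ≤-Reasoning
  reorderˡ : ∀ d F n → d * F * n ≡ d * n * F
  reorderˡ = solve-∀
  reorderʳ : ∀ num n d G → (num * n + d) * G ≡ num * G * n + G * d
  reorderʳ = solve-∀

excess-bound : ∀ Δ c n b a → Δ * n ≤ c → suc b < n → 1 ≤ c → Δ * suc b < suc a * c
excess-bound zero    c n b a _    _   1≤c = ≤-trans 1≤c (m≤m+n c (a * c))
excess-bound (suc δ) c n b a Δn≤c b<n _   = begin-strict
  suc δ * suc b  <⟨ *-monoʳ-< (suc δ) b<n ⟩
  suc δ * n      ≤⟨ Δn≤c ⟩
  c              ≤⟨ m≤m+n c (a * c) ⟩
  suc a * c      ∎
  where open ≤-Reasoning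

frac-converges : ∀ num d (f g : ℕ → ℕ) →
  (∀ t → 1 ≤ g (suc t)) →
  (∀ t → num * g (suc t) ≤ suc d * f (suc t)) →
  (∀ t → suc d * suc t * f (suc t) ≤ (num * suc t + suc d) * g (suc t)) →
  Converges (λ n → frac (f n) (g n)) (ℤ.+ num ℚ./ suc d)
frac-converges num d f g g≥1 lower upper (mkℚ ℤ.+0       _ _) ε>0 = ⊥-elim (ℤ.Positive.pos (ℚ.positive ε>0))
frac-converges num d f g g≥1 lower upper (mkℚ ℤ.-[1+ _ ] _ _) ε>0 = ⊥-elim (ℤ.Positive.pos (ℚ.positive ε>0))
frac-converges num d f g g≥1 lower upper (mkℚ ℤ.+[1+ a ] b c) _  = suc (suc b) , close
  where
  close : ∀ n → suc (suc b) ≤ n → ℚ.∣ frac (f n) (g n) ℚ.- ℤ.+ num ℚ./ suc d ∣ ℚ.< mkℚ ℤ.+[1+ a ] b c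
  close (suc t) b<n = within (g (suc t)) (g≥1 t) (lower t) (upper t)
    where
    F : ℕ
    F = f (suc t)
    within : ∀ G → 1 ≤ G → num * G ≤ suc d * F → suc d * suc t * F ≤ (num * suc t + suc d) * G →
             ℚ.∣ frac F G ℚ.- ℤ.+ num ℚ./ suc d ∣ ℚ.< mkℚ ℤ.+[1+ a ] b c
    within (suc G) _ lo up =
      frac-close F G num d a b c lo
        (excess-bound (suc d * F ∸ num * suc G) _ (suc t) b a (excess*n≤G*den num d F (suc G) (suc t) up) b<n (s≤s z≤n))

C-pos : ∀ {n k} → k ≤ n → 1 ≤ n C k
C-pos {n}     {zero}  _         = ≤-refl
C-pos {suc n} {suc k} (s≤s k≤n) =
  ≤-trans (C-pos k≤n) (≤-trans (m≤m+n _ _) (≤-reflexive (nCk+nC[k+1]≡[n+1]C[k+1] n k)))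

fIs-from-bounds : ∀ m num d p q → p + q ≡ m →
  (∀ t → num * completeDegree m (suc t) ≤ suc d * minDegree (suc t) p q) →
  (∀ t p q → p + q ≡ m → suc d * suc t * minDegree (suc t) p q ≤ (num * suc t + suc d) * completeDegree m (suc t)) →
  fIs (suc m) 2 (ℤ.+ num ℚ./ suc d)
fIs-from-bounds m num d p q pq lowerBound upperBound =
  (λ n → ratio (bestGraph m n)) , maxRatio m ,
  frac-converges num d (λ n → δ₁ (bestGraph m n)) (completeDegree m) positive lower upper
  where
  positive : ∀ t → 1 ≤ completeDegree m (suc t)
  positive t = C-pos (∸-monoˡ-≤ 1 (≤-trans (m≤m*n (suc m) 2) (m≤m*n (suc m * 2) (suc t))))
  lower : ∀ t → num * completeDegree m (suc t) ≤ suc d * δ₁ (bestGraph m (suc t))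
  lower t = ≤-trans (lowerBound t) (*-monoʳ-≤ (suc d) (minDegree≤δ₁-bestGraph t p q pq))
  upper : ∀ t → suc d * suc t * δ₁ (bestGraph m (suc t)) ≤ (num * suc t + suc d) * completeDegree m (suc t)
  upper t = viaSplit (δ₁≤minDegree t (bestGraph m (suc t)) (extremalGraph-InF (suc t) _ _ (bestSplit-sum m (suc t))))
    where
    viaSplit : ∃[ p ] ∃[ q ] p + q ≡ m × δ₁ (bestGraph m (suc t)) ≤ minDegree (suc t) p q →
               suc d * suc t * δ₁ (bestGraph m (suc t)) ≤ (num * suc t + suc d) * completeDegree m (suc t)
    viaSplit (p′ , q′ , pq′ , δ₁≤) = ≤-trans (*-monoʳ-≤ (suc d * suc t) δ₁≤) (upperBound t p′ q′ pq′)

-- Polynomials and falling factorials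

-- Inequalities between explicit polynomials are decided by comparing the coefficients of their normal forms.

infixl 6 _:+_
infixl 7 _:*_

data Expr : Set where
  X   : Expr
  con : ℕ → Expr
  _:+_ _:*_ : Expr → Expr → Expr

⟦_⟧ : Expr → ℕ → ℕ
⟦ X      ⟧ t = t
⟦ con c  ⟧ t = c
⟦ e :+ f ⟧ t = ⟦ e ⟧ t + ⟦ f ⟧ t
⟦ e :* f ⟧ t = ⟦ e ⟧ t * ⟦ f ⟧ t

-- constant term first
Coefficients : Set
Coefficients = List ℕ

eval : Coefficients → ℕ → ℕ
eval []       t = 0
eval (c ∷ cs) t = c + t * eval cs t

_⊕_ : Coefficients → Coefficients → Coefficients
[]       ⊕ ds       = ds
(c ∷ cs) ⊕ []       = c ∷ cs
(c ∷ cs) ⊕ (d ∷ ds) = c + d ∷ cs ⊕ ds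

scale : ℕ → Coefficients → Coefficients
scale c []       = []
scale c (d ∷ ds) = c * d ∷ scale c ds

_⊛_ : Coefficients → Coefficients → Coefficients
[]       ⊛ ds = []
(c ∷ cs) ⊛ ds = scale c ds ⊕ (0 ∷ cs ⊛ ds)

normal : Expr → Coefficients
normal X        = 0 ∷ 1 ∷ []
normal (con c)  = c ∷ []
normal (e :+ f) = normal e ⊕ normal f
normal (e :* f) = normal e ⊛ normal f

eval-⊕ : ∀ cs ds t → eval (cs ⊕ ds) t ≡ eval cs t + eval ds t
eval-⊕ []       ds       t = refl
eval-⊕ (c ∷ cs) []       t = sym (+-identityʳ _)
eval-⊕ (c ∷ cs) (d ∷ ds) t rewrite eval-⊕ cs ds t = shuffle c d t (eval cs t) (eval ds t)
  where shuffle : ∀ c d t x y → c + d + t * (x + y) ≡ c + t * x + (d + t * y)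
        shuffle = solve-∀

eval-scale : ∀ c ds t → eval (scale c ds) t ≡ c * eval ds t
eval-scale c []       t = sym (*-zeroʳ c)
eval-scale c (d ∷ ds) t rewrite eval-scale c ds t = shuffle c d t (eval ds t)
  where shuffle : ∀ c d t x → c * d + t * (c * x) ≡ c * (d + t * x)
        shuffle = solve-∀

eval-⊛ : ∀ cs ds t → eval (cs ⊛ ds) t ≡ eval cs t * eval ds t
eval-⊛ []       ds t = refl
eval-⊛ (c ∷ cs) ds t rewrite eval-⊕ (scale c ds) (0 ∷ cs ⊛ ds) t | eval-scale c ds t | eval-⊛ cs ds t =
  shuffle c t (eval cs t) (eval ds t)
  where shuffle : ∀ c t x y → c * y + t * (x * y) ≡ (c + t * x) * y
        shuffle = solve-∀

eval-normal : ∀ e t → eval (normal e) t ≡ ⟦ e ⟧ t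
eval-normal X        t = linear t
  where linear : ∀ t → t * (1 + t * 0) ≡ t
        linear = solve-∀
eval-normal (con c)  t = trans (cong (c +_) (*-zeroʳ t)) (+-identityʳ c)
eval-normal (e :+ f) t = trans (eval-⊕ (normal e) (normal f) t) (cong₂ _+_ (eval-normal e t) (eval-normal f t))
eval-normal (e :* f) t = trans (eval-⊛ (normal e) (normal f) t) (cong₂ _*_ (eval-normal e t) (eval-normal f t))

-- a missing coefficient counts as 0
_≤ᶜ_ : Coefficients → Coefficients → Bool
[]       ≤ᶜ ds       = true
(c ∷ cs) ≤ᶜ []       = (c ≡ᵇ 0) ∧ (cs ≤ᶜ [])
(c ∷ cs) ≤ᶜ (d ∷ ds) = (c ≤ᵇ d) ∧ (cs ≤ᶜ ds)

eval-mono : ∀ cs ds t → T (cs ≤ᶜ ds) → eval cs t ≤ eval ds t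
eval-mono []       ds       t _ = z≤n
eval-mono (c ∷ cs) []       t h with Equivalence.to (T-∧ {c ≡ᵇ 0}) h
... | c≡0 , cs≤0 rewrite ≡ᵇ⇒≡ c 0 c≡0 = ≤-trans (*-monoʳ-≤ t (eval-mono cs [] t cs≤0)) (≤-reflexive (*-zeroʳ t))
eval-mono (c ∷ cs) (d ∷ ds) t h with Equivalence.to (T-∧ {c ≤ᵇ d}) h
... | c≤d , cs≤ds = +-mono-≤ (≤ᵇ⇒≤ c d c≤d) (*-monoʳ-≤ t (eval-mono cs ds t cs≤ds))

poly-≤ : ∀ e f {_ : T (normal e ≤ᶜ normal f)} t → ⟦ e ⟧ t ≤ ⟦ f ⟧ t
poly-≤ e f {e≤f} t = subst₂ _≤_ (eval-normal e t) (eval-normal f t) (eval-mono (normal e) (normal f) t e≤f)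

falling : ℕ → ℕ → ℕ
falling x zero    = 1
falling x (suc k) = x * falling (pred x) k

absorption : ∀ n k → suc k * (suc n C suc k) ≡ suc n * (n C k)
absorption zero    zero    = refl
absorption zero    (suc k) = *-zeroʳ (suc (suc k))
absorption (suc n) zero    = trans (+-identityʳ _) (trans (nC1≡n (suc (suc n))) (sym (*-identityʳ (suc (suc n)))))
absorption (suc n) (suc k) = begin
  suc (suc k) * (suc (suc n) C suc (suc k))
    ≡⟨ cong (suc (suc k) *_) (nCk+nC[k+1]≡[n+1]C[k+1] (suc n) (suc k)) ⟨
  suc (suc k) * (suc n C suc k + suc n C suc (suc k))
    ≡⟨ shuffle k (suc n C suc k) (suc n C suc (suc k)) ⟩
  suc k * (suc n C suc k) + suc n C suc k + suc (suc k) * (suc n C suc (suc k))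
    ≡⟨ cong₂ (λ x y → x + suc n C suc k + y) (absorption n k) (absorption n (suc k)) ⟩
  suc n * (n C k) + suc n C suc k + suc n * (n C suc k)
    ≡⟨ shuffle′ (suc n) (n C k) (suc n C suc k) (n C suc k) ⟩
  suc n * (n C k + n C suc k) + suc n C suc k
    ≡⟨ cong (λ x → suc n * x + suc n C suc k) (nCk+nC[k+1]≡[n+1]C[k+1] n k) ⟩
  suc n * (suc n C suc k) + suc n C suc k
    ≡⟨ +-comm (suc n * (suc n C suc k)) _ ⟩
  suc (suc n) * (suc n C suc k) ∎
  where
  open ≡-Reasoning
  shuffle : ∀ k x y → (2 + k) * (x + y) ≡ (1 + k) * x + x + (2 + k) * y
  shuffle = solve-∀
  shuffle′ : ∀ a x y z → a * x + y + a * z ≡ a * (x + z) + y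
  shuffle′ = solve-∀

!*C≡falling : ∀ n k → k ! * (n C k) ≡ falling n k
!*C≡falling n       zero    = refl
!*C≡falling zero    (suc k) = *-zeroʳ (suc k !)
!*C≡falling (suc n) (suc k) = begin
  suc k * k ! * (suc n C suc k)    ≡⟨ shuffle (suc k) (k !) (suc n C suc k) ⟩
  k ! * (suc k * (suc n C suc k))  ≡⟨ cong (k ! *_) (absorption n k) ⟩
  k ! * (suc n * (n C k))          ≡⟨ shuffle′ (k !) (suc n) (n C k) ⟩
  suc n * (k ! * (n C k))          ≡⟨ cong (suc n *_) (!*C≡falling n k) ⟩
  suc n * falling n k              ∎
  where
  open ≡-Reasoning
  shuffle : ∀ a b c → a * b * c ≡ b * (a * c)
  shuffle = solve-∀
  shuffle′ : ∀ a b c → a * (b * c) ≡ b * (a * c)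
  shuffle′ = solve-∀

-- ⟦ fallingExpr c e k ⟧ t = (e + c t)(e − 1 + c t) ⋯ (e − k + 1 + c t), i.e. falling (e + c t) k if k ≤ e + 1
fallingExpr : ℕ → ℕ → ℕ → Expr
fallingExpr c e zero    = con 1
fallingExpr c e (suc k) = (con e :+ con c :* X) :* fallingExpr c (pred e) k

typeDegree-falling : ∀ s t a b c {M} → a ! * b ! * c ≡ M →
  M * typeDegree s t (suc a) b ≡ c * (falling (pred s) a * falling t b)
typeDegree-falling s t a b c refl = begin
  a ! * b ! * c * ((pred s C a) * (t C b))     ≡⟨ shuffle (a !) (b !) c (pred s C a) (t C b) ⟩
  c * (a ! * (pred s C a) * (b ! * (t C b)))
    ≡⟨ cong₂ (λ x y → c * (x * y)) (!*C≡falling (pred s) a) (!*C≡falling t b) ⟩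
  c * (falling (pred s) a * falling t b)       ∎
  where
  open ≡-Reasoning
  shuffle : ∀ a b c x y → a * b * c * (x * y) ≡ c * (a * x * (b * y))
  shuffle = solve-∀

splitDegree-falling : ∀ s t p q c {M Y} → p ! * q ! * c ≡ M → M * typeDegree s t p (suc q) ≡ Y →
  M * splitDegree s t p q ≡ c * (falling (pred s) p * falling t q) + Y
splitDegree-falling s t p q c {M} eq second =
  trans (*-distribˡ-+ M _ _) (cong₂ _+_ (typeDegree-falling s t p q c eq) second)

splitDegree-*suc : ∀ a b t p q → splitDegree (a * suc t) (b * suc t) p q ≡ splitDegree (a + a * t) (b + b * t) p q
splitDegree-*suc a b t p q = cong₂ (λ s s′ → splitDegree s s′ p q) (*-suc a t) (*-suc b t)

C-*suc : ∀ a t k → (a * suc t ∸ 1) C k ≡ (a + a * t ∸ 1) C k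
C-*suc a t k = cong (λ s → (s ∸ 1) C k) (*-suc a t)

scaled-≤ : ∀ M .{{_ : NonZero M}} a b x y {X Y} → M * x ≡ X → M * y ≡ Y → a * X ≤ b * Y → a * x ≤ b * y
scaled-≤ M a b x y refl refl aX≤bY = *-cancelˡ-≤ M (begin
  M * (a * x)  ≡⟨ swap M a x ⟩
  a * (M * x)  ≤⟨ aX≤bY ⟩
  b * (M * y)  ≡⟨ swap M b y ⟨
  M * (b * y)  ∎)
  where
  open ≤-Reasoning
  swap : ∀ m a x → m * (a * x) ≡ a * (m * x)
  swap = solve-∀

-- k = 3 and k = 4

-- Here n = t + 1, and multiplying by 2! turns every binomial coefficient into a polynomial in t.
module Bounds₃ (t : ℕ) where
  n : ℕ
  n = suc t

  K d₀₂ d₁₁ : ℕ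
  K   = completeDegree 2 n
  d₀₂ = splitDegree (1 * n) (5 * n) 0 2
  d₁₁ = splitDegree (3 * n) (3 * n) 1 1

  poly-K poly-d₀₂ poly-d₁₁ : Expr
  poly-K   = fallingExpr 6 5 2
  poly-d₀₂ = con 1 :* (con 1 :* fallingExpr 5 5 2) :+ con 0
  poly-d₁₁ = con 2 :* (fallingExpr 3 2 1 :* fallingExpr 3 3 1) :+ con 1 :* (con 1 :* fallingExpr 3 3 2)

  K≡poly : 2 * K ≡ ⟦ poly-K ⟧ t
  K≡poly = trans (cong (2 *_) (C-*suc 6 t 2)) (!*C≡falling (5 + 6 * t) 2)

  d₀₂≡poly : 2 * d₀₂ ≡ ⟦ poly-d₀₂ ⟧ t
  d₀₂≡poly = trans (cong (2 *_) (splitDegree-*suc 1 5 t 0 2))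
                   (splitDegree-falling (1 + 1 * t) (5 + 5 * t) 0 2 1 refl refl)

  d₁₁≡poly : 2 * d₁₁ ≡ ⟦ poly-d₁₁ ⟧ t
  d₁₁≡poly = trans (cong (2 *_) (splitDegree-*suc 3 3 t 1 1))
                   (splitDegree-falling s s 1 1 2 refl (typeDegree-falling s s 0 2 1 refl))
    where s : ℕ
          s = 3 + 3 * t

  upper-0-2 : 4 * n * d₀₂ ≤ (3 * n + 4) * K
  upper-0-2 = scaled-≤ 2 (4 * n) (3 * n + 4) d₀₂ K d₀₂≡poly K≡poly
    (poly-≤ (con 4 :* (con 1 :+ X) :* poly-d₀₂) ((con 3 :* (con 1 :+ X) :+ con 4) :* poly-K) t)

  upper-1-1 : 4 * n * d₁₁ ≤ (3 * n + 4) * K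
  upper-1-1 = scaled-≤ 2 (4 * n) (3 * n + 4) d₁₁ K d₁₁≡poly K≡poly
    (poly-≤ (con 4 :* (con 1 :+ X) :* poly-d₁₁) ((con 3 :* (con 1 :+ X) :+ con 4) :* poly-K) t)

  lower-1-1 : 3 * K ≤ 4 * d₁₁
  lower-1-1 = scaled-≤ 2 3 4 K d₁₁ K≡poly d₁₁≡poly (poly-≤ (con 3 :* poly-K) (con 4 :* poly-d₁₁) t)

-- Here n = t + 1, and multiplying by 3! turns every binomial coefficient into a polynomial in t.
module Bounds₄ (t : ℕ) where
  n : ℕ
  n = suc t

  K d₀₃ d₁₂ d₂₁ : ℕ
  K   = completeDegree 3 n
  d₀₃ = splitDegree (1 * n) (7 * n) 0 3
  d₁₂ = splitDegree (3 * n) (5 * n) 1 2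
  d₂₁ = splitDegree (5 * n) (3 * n) 2 1

  poly-K poly-d₀₃ poly-d₁₂ poly-d₂₁ : Expr
  poly-K   = fallingExpr 8 7 3
  poly-d₀₃ = con 1 :* (con 1 :* fallingExpr 7 7 3) :+ con 0
  poly-d₁₂ = con 3 :* (fallingExpr 3 2 1 :* fallingExpr 5 5 2) :+ con 1 :* (con 1 :* fallingExpr 5 5 3)
  poly-d₂₁ = con 3 :* (fallingExpr 5 4 2 :* fallingExpr 3 3 1) :+ con 3 :* (fallingExpr 5 4 1 :* fallingExpr 3 3 2)

  K≡poly : 6 * K ≡ ⟦ poly-K ⟧ t
  K≡poly = trans (cong (6 *_) (C-*suc 8 t 3)) (!*C≡falling (7 + 8 * t) 3)

  d₀₃≡poly : 6 * d₀₃ ≡ ⟦ poly-d₀₃ ⟧ t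
  d₀₃≡poly = trans (cong (6 *_) (splitDegree-*suc 1 7 t 0 3))
                   (splitDegree-falling (1 + 1 * t) (7 + 7 * t) 0 3 1 refl refl)

  d₁₂≡poly : 6 * d₁₂ ≡ ⟦ poly-d₁₂ ⟧ t
  d₁₂≡poly = trans (cong (6 *_) (splitDegree-*suc 3 5 t 1 2))
                   (splitDegree-falling s s′ 1 2 3 refl (typeDegree-falling s s′ 0 3 1 refl))
    where s s′ : ℕ
          s  = 3 + 3 * t
          s′ = 5 + 5 * t

  d₂₁≡poly : 6 * d₂₁ ≡ ⟦ poly-d₂₁ ⟧ t
  d₂₁≡poly = trans (cong (6 *_) (splitDegree-*suc 5 3 t 2 1))
                   (splitDegree-falling s s′ 2 1 3 refl (typeDegree-falling s s′ 1 2 3 refl))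
    where s s′ : ℕ
          s  = 5 + 5 * t
          s′ = 3 + 3 * t

  upper-0-3 : 256 * n * d₀₃ ≤ (175 * n + 256) * K
  upper-0-3 = scaled-≤ 6 (256 * n) (175 * n + 256) d₀₃ K d₀₃≡poly K≡poly
    (poly-≤ (con 256 :* (con 1 :+ X) :* poly-d₀₃) ((con 175 :* (con 1 :+ X) :+ con 256) :* poly-K) t)

  upper-1-2 : 256 * n * d₁₂ ≤ (175 * n + 256) * K
  upper-1-2 = scaled-≤ 6 (256 * n) (175 * n + 256) d₁₂ K d₁₂≡poly K≡poly
    (poly-≤ (con 256 :* (con 1 :+ X) :* poly-d₁₂) ((con 175 :* (con 1 :+ X) :+ con 256) :* poly-K) t)

  lower-1-2 : 175 * K ≤ 256 * d₁₂
  lower-1-2 = scaled-≤ 6 175 256 K d₁₂ K≡poly d₁₂≡poly (poly-≤ (con 175 :* poly-K) (con 256 :* poly-d₁₂) t)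

  lower-2-1 : 175 * K ≤ 256 * d₂₁
  lower-2-1 = scaled-≤ 6 175 256 K d₂₁ K≡poly d₂₁≡poly (poly-≤ (con 175 :* poly-K) (con 256 :* poly-d₂₁) t)

f₃ : fIs 3 2 (ℤ.+ 3 ℚ./ 4)
f₃ = fIs-from-bounds 2 3 3 1 1 refl lower upper
  where
  open Bounds₃
  lower : ∀ t → 3 * K t ≤ 4 * minDegree (suc t) 1 1
  lower t = ≤-trans (⊓-glb (lower-1-1 t) (lower-1-1 t)) (≤-reflexive (sym (*-distribˡ-⊓ 4 (d₁₁ t) (d₁₁ t))))
  upper : ∀ t p q → p + q ≡ 2 → 4 * suc t * minDegree (suc t) p q ≤ (3 * suc t + 4) * K t
  upper t 0 2 refl = ≤-trans (*-monoʳ-≤ (4 * suc t) (m⊓n≤m _ _)) (upper-0-2 t)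
  upper t 1 1 refl = ≤-trans (*-monoʳ-≤ (4 * suc t) (m⊓n≤m _ _)) (upper-1-1 t)
  upper t 2 0 refl = ≤-trans (*-monoʳ-≤ (4 * suc t) (m⊓n≤n _ _)) (upper-0-2 t)

f₄ : fIs 4 2 (ℤ.+ 175 ℚ./ 256)
f₄ = fIs-from-bounds 3 175 255 1 2 refl lower upper
  where
  open Bounds₄
  lower : ∀ t → 175 * K t ≤ 256 * minDegree (suc t) 1 2
  lower t = ≤-trans (⊓-glb (lower-1-2 t) (lower-2-1 t)) (≤-reflexive (sym (*-distribˡ-⊓ 256 (d₁₂ t) (d₂₁ t))))
  upper : ∀ t p q → p + q ≡ 3 → 256 * suc t * minDegree (suc t) p q ≤ (175 * suc t + 256) * K t
  upper t 0 3 refl = ≤-trans (*-monoʳ-≤ (256 * suc t) (m⊓n≤m _ _)) (upper-0-3 t)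
  upper t 1 2 refl = ≤-trans (*-monoʳ-≤ (256 * suc t) (m⊓n≤m _ _)) (upper-1-2 t)
  upper t 2 1 refl = ≤-trans (*-monoʳ-≤ (256 * suc t) (m⊓n≤n _ _)) (upper-1-2 t)
  upper t 3 0 refl = ≤-trans (*-monoʳ-≤ (256 * suc t) (m⊓n≤n _ _)) (upper-0-3 t)

open import Data.Integer using (+_)
open import Data.Rational using (_/_)

lemma1p6 : fIs 3 2 ((+ 3) / 4) × fIs 4 2 ((+ 175) / 256)
lemma1p6 = f₃ , f₄
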